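{- Let $C_{22}(1,3)$ be the graph with vertex set $\{v_0,\dots,v_{21}\}$ and edge set $\{v_iv_{i+1}\}_{0\le i\le 21}\cup\{v_iv_{i+3}\}_{0\le i\le 21}$, indices modulo $22$. Then $\chi''(C_{22}(1,3)) = 5$.
   Context: A total $k$-colouring of a simple graph $G$ is a map $\sigma: V(G)\cup E(G)\to\{1,\dots,k\}$ such that adjacent vertices receive distinct colours, adjacent edges receive distinct colours, and each vertex receives a colour different from those of its incident edges. $\chi''(G)$ is the least such $k$. -}

module Defs where

open import Data.Nat using (ℕ; _+_; _≤_; _≡ᵇ_; _%_)
open import Data.Fin using (Fin; toℕ; zero; suc)
open import Data.Bool using (Bool; true; false; _∨_; T)
open import Data.Product using (_×_)
open import Relation.Nullary using (¬_)
open import Relation.Binary.PropositionalEquality using (_≡_; _≢_)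

record SimpleGraph (n : ℕ) : Set where
  field
    adj     : Fin n → Fin n → Bool
    adj-sym : ∀ u v → T (adj u v) → T (adj v u)
    adj-irr : ∀ u → ¬ T (adj u u)
open SimpleGraph public

-- The edge colour is given on ordered adjacent pairs and required to be
-- symmetric, so it is a function on the (unordered) edges.
record TotalColouring {n : ℕ} (G : SimpleGraph n) (k : ℕ) : Set where
  field
    vcol     : Fin n → Fin k
    ecol     : (u v : Fin n) → T (adj G u v) → Fin k
    ecol-sym : ∀ u v (p : T (adj G u v)) (q : T (adj G v u)) →
               ecol u v p ≡ ecol v u q
    vertex-proper : ∀ u v (p : T (adj G u v)) → vcol u ≢ vcol v
    edge-proper : ∀ u v w (p : T (adj G u v)) (q : T (adj G u w)) →
                  v ≢ w → ecol u v p ≢ ecol u w q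
    incidence : ∀ u v (p : T (adj G u v)) → vcol u ≢ ecol u v p

TotalChromaticNumber : {n : ℕ} → SimpleGraph n → ℕ → Set
TotalChromaticNumber G k =
  TotalColouring G k × (∀ m → TotalColouring G m → k ≤ m)

c22adj : Fin 22 → Fin 22 → Bool
c22adj i j =
  (((toℕ i + 1) % 22) ≡ᵇ toℕ j) ∨ (((toℕ i + 3) % 22) ≡ᵇ toℕ j) ∨
  (((toℕ j + 1) % 22) ≡ᵇ toℕ i) ∨ (((toℕ j + 3) % 22) ≡ᵇ toℕ i)

private
  swap4 : ∀ a b c d → T (a ∨ b ∨ c ∨ d) → T (c ∨ d ∨ a ∨ b)
  swap4 true true true true t = _
  swap4 true true true false t = _
  swap4 true true false true t = _
  swap4 true true false false t = _
  swap4 true false true true t = _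
  swap4 true false true false t = _
  swap4 true false false true t = _
  swap4 true false false false t = _
  swap4 false true true true t = _
  swap4 false true true false t = _
  swap4 false true false true t = _
  swap4 false true false false t = _
  swap4 false false true true t = _
  swap4 false false true false t = _
  swap4 false false false true t = _
  swap4 false false false false ()

  c22-irr : ∀ u → ¬ T (c22adj u u)
  c22-irr zero ()
  c22-irr (suc zero) ()
  c22-irr (suc (suc zero)) ()
  c22-irr (suc (suc (suc zero))) ()
  c22-irr (suc (suc (suc (suc zero)))) ()
  c22-irr (suc (suc (suc (suc (suc zero))))) ()
  c22-irr (suc (suc (suc (suc (suc (suc zero)))))) ()
  c22-irr (suc (suc (suc (suc (suc (suc (suc zero))))))) ()
  c22-irr (suc (suc (suc (suc (suc (suc (suc (suc zero)))))))) ()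
  c22-irr (suc (suc (suc (suc (suc (suc (suc (suc (suc zero))))))))) ()
  c22-irr (suc (suc (suc (suc (suc (suc (suc (suc (suc (suc zero)))))))))) ()
  c22-irr (suc (suc (suc (suc (suc (suc (suc (suc (suc (suc (suc zero))))))))))) ()
  c22-irr (suc (suc (suc (suc (suc (suc (suc (suc (suc (suc (suc (suc zero)))))))))))) ()
  c22-irr (suc (suc (suc (suc (suc (suc (suc (suc (suc (suc (suc (suc (suc zero))))))))))))) ()
  c22-irr (suc (suc (suc (suc (suc (suc (suc (suc (suc (suc (suc (suc (suc (suc zero)))))))))))))) ()
  c22-irr (suc (suc (suc (suc (suc (suc (suc (suc (suc (suc (suc (suc (suc (suc (suc zero))))))))))))))) ()
  c22-irr (suc (suc (suc (suc (suc (suc (suc (suc (suc (suc (suc (suc (suc (suc (suc (suc zero)))))))))))))))) ()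
  c22-irr (suc (suc (suc (suc (suc (suc (suc (suc (suc (suc (suc (suc (suc (suc (suc (suc (suc zero))))))))))))))))) ()
  c22-irr (suc (suc (suc (suc (suc (suc (suc (suc (suc (suc (suc (suc (suc (suc (suc (suc (suc (suc zero)))))))))))))))))) ()
  c22-irr (suc (suc (suc (suc (suc (suc (suc (suc (suc (suc (suc (suc (suc (suc (suc (suc (suc (suc (suc zero))))))))))))))))))) ()
  c22-irr (suc (suc (suc (suc (suc (suc (suc (suc (suc (suc (suc (suc (suc (suc (suc (suc (suc (suc (suc (suc zero)))))))))))))))))))) ()
  c22-irr (suc (suc (suc (suc (suc (suc (suc (suc (suc (suc (suc (suc (suc (suc (suc (suc (suc (suc (suc (suc (suc zero))))))))))))))))))))) ()

C22[1,3] : SimpleGraph 22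
C22[1,3] = record
  { adj     = c22adj
  ; adj-sym = λ u v → swap4 (((toℕ u + 1) % 22) ≡ᵇ toℕ v) (((toℕ u + 3) % 22) ≡ᵇ toℕ v)
                            (((toℕ v + 1) % 22) ≡ᵇ toℕ u) (((toℕ v + 3) % 22) ≡ᵇ toℕ u)
  ; adj-irr = c22-irr
  }

{-# OPTIONS --safe #-}
-- Every vertex of C₂₂(1,3) has four neighbours, and a vertex together with its
-- incident edges must receive pairwise distinct colours, so χ'' ≥ 5.  An explicit
-- total 5-colouring, verified by exhaustive decision, gives χ'' ≤ 5.
module Submission where

open import Defs
open import Data.Nat as ℕ using (ℕ; _≤_; _<_; _≡ᵇ_; _%_; _+_)
open import Data.Fin using (Fin; toℕ; zero; suc; #_; _≟_)
open import Data.Fin.Properties using (all?; injective⇒≤)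
open import Data.Vec using (Vec; _∷_; []; lookup)
open import Data.Bool using (T; if_then_else_)
open import Data.Product using (_×_; _,_)
open import Data.Unit using (tt)
open import Data.Empty using (⊥-elim)
open import Function.Definitions using (Injective)
open import Relation.Nullary using (Dec; yes; no; ¬?)
open import Relation.Nullary.Decidable using (toWitness; _→-dec_; _×-dec_)
open import Relation.Nullary.Decidable.Core using (T?)
open import Relation.Binary.PropositionalEquality using (_≡_; _≢_; refl; sym; cong)

module _ {n k : ℕ} {G : SimpleGraph n} (σ : TotalColouring G k) where
  open TotalColouring σ

  neighbours<colours : ∀ {d} u (nb : Fin d → Fin n) → Injective _≡_ _≡_ nb →
                       (∀ i → T (adj G u (nb i))) → d < k
  neighbours<colours {d} u nb nb-inj nb-adj = injective⇒≤ colour-inj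
    where
    colour : Fin (ℕ.suc d) → Fin k
    colour zero    = vcol u
    colour (suc i) = ecol u (nb i) (nb-adj i)

    colour-inj : Injective _≡_ _≡_ colour
    colour-inj {zero}  {zero}  _  = refl
    colour-inj {zero}  {suc j} eq = ⊥-elim (incidence u (nb j) (nb-adj j) eq)
    colour-inj {suc i} {zero}  eq = ⊥-elim (incidence u (nb i) (nb-adj i) (sym eq))
    colour-inj {suc i} {suc j} eq with nb i ≟ nb j
    ... | yes nbi≡nbj = cong suc (nb-inj nbi≡nbj)
    ... | no  nbi≢nbj = ⊥-elim (edge-proper u (nb i) (nb j) (nb-adj i) (nb-adj j) nbi≢nbj eq)

module _ {n k : ℕ} (G : SimpleGraph n) (vc : Fin n → Fin k) (ec : Fin n → Fin n → Fin k) where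

  OnEdges : (Fin n → Fin n → Set) → Set
  OnEdges R = ∀ u v → T (adj G u v) → R u v

  onEdges? : ∀ {R} → (∀ u v → Dec (R u v)) → Dec (OnEdges R)
  onEdges? R? = all? λ u → all? λ v → T? (adj G u v) →-dec R? u v

  IsTotalColouring : Set
  IsTotalColouring =
    OnEdges (λ u v → ec u v ≡ ec v u) ×
    OnEdges (λ u v → vc u ≢ vc v) ×
    OnEdges (λ u v → ∀ w → T (adj G u w) → v ≢ w → ec u v ≢ ec u w) ×
    OnEdges (λ u v → vc u ≢ ec u v)

  isTotalColouring? : Dec IsTotalColouring
  isTotalColouring? =
    onEdges? (λ u v → ec u v ≟ ec v u) ×-dec
    onEdges? (λ u v → ¬? (vc u ≟ vc v)) ×-dec
    onEdges? (λ u v → all? λ w → T? (adj G u w) →-dec (¬? (v ≟ w) →-dec ¬? (ec u v ≟ ec u w))) ×-dec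
    onEdges? (λ u v → ¬? (vc u ≟ ec u v))

  toTotalColouring : IsTotalColouring → TotalColouring G k
  toTotalColouring (sym-ok , vertex-ok , edge-ok , incidence-ok) = record
    { vcol          = vc
    ; ecol          = λ u v _ → ec u v
    ; ecol-sym      = λ u v p _ → sym-ok u v p
    ; vertex-proper = vertex-ok
    ; edge-proper   = λ u v w p q → edge-ok u v p w q
    ; incidence     = incidence-ok
    }

-- Vertex colours of v_i, and colours of the edges v_i v_{i+1} and v_i v_{i+3}.
vertexColours jump1Colours jump3Colours : Vec (Fin 5) 22
vertexColours = # 0 ∷ # 2 ∷ # 1 ∷ # 4 ∷ # 1 ∷ # 0 ∷ # 2 ∷ # 3 ∷ # 2 ∷ # 3 ∷ # 0 ∷ # 1 ∷ # 2 ∷ # 1 ∷ # 3 ∷ # 1 ∷ # 3 ∷ # 0 ∷ # 4 ∷ # 2 ∷ # 1 ∷ # 2 ∷ []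
jump1Colours  = # 1 ∷ # 0 ∷ # 3 ∷ # 0 ∷ # 4 ∷ # 3 ∷ # 0 ∷ # 4 ∷ # 0 ∷ # 2 ∷ # 4 ∷ # 0 ∷ # 4 ∷ # 0 ∷ # 4 ∷ # 0 ∷ # 4 ∷ # 3 ∷ # 0 ∷ # 3 ∷ # 0 ∷ # 3 ∷ []
jump3Colours  = # 2 ∷ # 3 ∷ # 2 ∷ # 1 ∷ # 2 ∷ # 1 ∷ # 4 ∷ # 1 ∷ # 3 ∷ # 1 ∷ # 3 ∷ # 2 ∷ # 3 ∷ # 2 ∷ # 1 ∷ # 2 ∷ # 1 ∷ # 2 ∷ # 1 ∷ # 4 ∷ # 4 ∷ # 4 ∷ []

_+ₘ_ : Fin 22 → ℕ → ℕ
i +ₘ s = (toℕ i + s) % 22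

-- The last branch is reached on non-edges too; its value there is irrelevant.
edgeColour : Fin 22 → Fin 22 → Fin 5
edgeColour u v =
  if      u +ₘ 1 ≡ᵇ toℕ v then lookup jump1Colours u
  else if u +ₘ 3 ≡ᵇ toℕ v then lookup jump3Colours u
  else if v +ₘ 1 ≡ᵇ toℕ u then lookup jump1Colours v
  else                         lookup jump3Colours v

C22[1,3]-5-colouring : TotalColouring C22[1,3] 5
C22[1,3]-5-colouring = toTotalColouring C22[1,3] (lookup vertexColours) edgeColour
  (toWitness {a? = isTotalColouring? C22[1,3] (lookup vertexColours) edgeColour} tt)

neighbours-of-v₀ : Vec (Fin 22) 4
neighbours-of-v₀ = # 1 ∷ # 3 ∷ # 19 ∷ # 21 ∷ []

5≤colours : ∀ {m} → TotalColouring C22[1,3] m → 5 ≤ m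
5≤colours σ = neighbours<colours σ (# 0) (lookup neighbours-of-v₀) lookup-injective adjacent
  where
  lookup-injective : Injective _≡_ _≡_ (lookup neighbours-of-v₀)
  lookup-injective {i} {j} = toWitness {a? = all? λ i → all? λ j →
    (lookup neighbours-of-v₀ i ≟ lookup neighbours-of-v₀ j) →-dec (i ≟ j)} tt i j

  adjacent : ∀ i → T (c22adj (# 0) (lookup neighbours-of-v₀ i))
  adjacent = toWitness {a? = all? λ i → T? (c22adj (# 0) (lookup neighbours-of-v₀ i))} tt

lemma8 : TotalChromaticNumber C22[1,3] 5
lemma8 = C22[1,3]-5-colouring , λ _ → 5≤colours
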